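{- Every $\Gamma h$-perfect graph is $\omega\chi$-perfect; that is, if $G$ is a finite graph with $\Gamma(H)=h(H)$ for every induced subgraph $H$ of $G$, then $\omega(H)=\chi(H)$ for every induced subgraph $H$ of $G$.
   Context: All graphs are finite and simple. A $k$-coloring of $G$ is a surjective map $\varsigma\colon V(G)\to\{1,\dots,k\}$; it is proper if adjacent vertices get different colors. A Grundy $k$-coloring is a proper $k$-coloring in which every vertex of color $i$ is adjacent to some vertex of color $j$ for every $j<i$; the Grundy number $\Gamma(G)$ is the largest $k$ for which $G$ has a Grundy $k$-coloring. The Hadwiger number $h(G)$ is the largest $k$ such that $K_k$ is a minor of $G$. $\omega(G)$ is the clique number and $\chi(G)$ the chromatic number. -}

module Defs where

open import Data.Nat using (ℕ; _≤_; _<_)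
open import Data.Fin using (Fin; toℕ)
open import Data.Bool using (Bool; true; false)
open import Data.Maybe using (Maybe; just; nothing)
open import Data.Product using (Σ; ∃; ∃-syntax; _×_; _,_)
open import Relation.Binary.PropositionalEquality using (_≡_)
open import Relation.Nullary using (¬_)
open import Function.Definitions using (Injective; Surjective)

record Graph (n : ℕ) : Set where
  field
    adj     : Fin n → Fin n → Bool
    adj-sym : ∀ u v → adj u v ≡ adj v u
    adj-irr : ∀ v → adj v v ≡ false

open Graph public

Adj : ∀ {n} → Graph n → Fin n → Fin n → Set
Adj G u v = adj G u v ≡ true

induced : ∀ {n m} (G : Graph n) (f : Fin m → Fin n) → Graph m
induced G f = record
  { adj     = λ u v → adj G (f u) (f v)
  ; adj-sym = λ u v → adj-sym G (f u) (f v)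
  ; adj-irr = λ v → adj-irr G (f v)
  }

IsInducedSubgraph : ∀ {m n} → Graph m → Graph n → Set
IsInducedSubgraph {m} {n} H G =
  Σ (Fin m → Fin n) λ f → Injective _≡_ _≡_ f × (∀ u v → adj H u v ≡ adj G (f u) (f v))

IsMax : (ℕ → Set) → ℕ → Set
IsMax P k = P k × (∀ j → P j → j ≤ k)

IsMin : (ℕ → Set) → ℕ → Set
IsMin P k = P k × (∀ j → P j → k ≤ j)

Proper : ∀ {n k} → Graph n → (Fin n → Fin k) → Set
Proper G c = ∀ u v → Adj G u v → ¬ (c u ≡ c v)

-- Grundy k-colouring: surjective proper colouring (colours 0..k-1 stand for 1..k)
-- such that every vertex of colour i has a neighbour of colour j for every j < i.
GrundyColoring : ∀ {n k} → Graph n → (Fin n → Fin k) → Set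
GrundyColoring {n} {k} G c =
  Surjective _≡_ _≡_ c × Proper G c ×
  (∀ v (j : Fin k) → toℕ j < toℕ (c v) → ∃[ u ] (Adj G v u × c u ≡ j))

HasGrundyColoring : ∀ {n} → Graph n → ℕ → Set
HasGrundyColoring {n} G k = Σ (Fin n → Fin k) λ c → GrundyColoring G c

IsGrundyNumber : ∀ {n} → Graph n → ℕ → Set
IsGrundyNumber G = IsMax (HasGrundyColoring G)

HasProperColoring : ∀ {n} → Graph n → ℕ → Set
HasProperColoring {n} G k = Σ (Fin n → Fin k) λ c → Proper G c

IsChromaticNumber : ∀ {n} → Graph n → ℕ → Set
IsChromaticNumber G = IsMin (HasProperColoring G)

HasClique : ∀ {n} → Graph n → ℕ → Set
HasClique {n} G k =
  Σ (Fin k → Fin n) λ f → Injective _≡_ _≡_ f × (∀ i j → ¬ (i ≡ j) → Adj G (f i) (f j))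

IsCliqueNumber : ∀ {n} → Graph n → ℕ → Set
IsCliqueNumber G = IsMax (HasClique G)

data ReachIn {n} (G : Graph n) (P : Fin n → Set) (u : Fin n) : Fin n → Set where
  here : P u → ReachIn G P u u
  step : ∀ {v w} → ReachIn G P u v → Adj G v w → P w → ReachIn G P u w

-- K_k minor via branch sets: b assigns each vertex to at most one branch set (Fin k);
-- every branch set is nonempty and connected, and any two distinct branch sets are
-- joined by an edge.
KMinorModel : ∀ {n k} → Graph n → (Fin n → Maybe (Fin k)) → Set
KMinorModel {n} {k} G b =
  (∀ (i : Fin k) → ∃[ v ] (b v ≡ just i)) ×
  (∀ (i : Fin k) u v → b u ≡ just i → b v ≡ just i → ReachIn G (λ w → b w ≡ just i) u v) ×
  (∀ (i j : Fin k) → ¬ (i ≡ j) → ∃[ u ] ∃[ v ] (b u ≡ just i × b v ≡ just j × Adj G u v))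

HasCompleteMinor : ∀ {n} → Graph n → ℕ → Set
HasCompleteMinor {n} G k = Σ (Fin n → Maybe (Fin k)) λ b → KMinorModel G b

IsHadwigerNumber : ∀ {n} → Graph n → ℕ → Set
IsHadwigerNumber G = IsMax (HasCompleteMinor G)

ΓhPerfect : ∀ {n} → Graph n → Set
ΓhPerfect G = ∀ {m} (H : Graph m) → IsInducedSubgraph H G →
  ∀ a b → IsGrundyNumber H a → IsHadwigerNumber H b → a ≡ b

ωχPerfect : ∀ {n} → Graph n → Set
ωχPerfect G = ∀ {m} (H : Graph m) → IsInducedSubgraph H G →
  ∀ a b → IsCliqueNumber H a → IsChromaticNumber H b → a ≡ b

module Submission where

-- The path P₄ (vertices 0-1-2-3) has Grundy number 3 but Hadwiger number 2,
-- so a Γh-perfect graph contains no induced P₄, and P₄-freeness passes to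
-- induced subgraphs.  It then remains to show ω(H) = χ(H) for P₄-free H.
-- Always ω ≤ χ, since a clique is coloured injectively.  For χ ≤ ω take an
-- optimal proper colouring and repeatedly recolour a vertex v with a smaller
-- colour j missing from its neighbourhood; this keeps the colouring proper and
-- strictly lowers the sum of all colours, so it ends with a colouring satisfying
-- the Grundy condition.  In a P₄-free graph, a vertex of colour i in such a
-- colouring lies in a clique of size i + 1: its neighbours of smaller colour
-- again satisfy the Grundy condition, since otherwise an induced P₄ appears.
-- By minimality of χ the top colour χ - 1 is used, giving a clique of size χ.

open import Defs
open import Data.Bool using (Bool; true; false)
open import Data.Bool.Properties using (¬-not) renaming (_≟_ to _≟ᵇ_)
open import Data.Empty using (⊥; ⊥-elim)
open import Data.Fin using (Fin; zero; suc; toℕ; fromℕ<; lower₁; _≟_)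
open import Data.Fin.Properties
  using (any?; all?; toℕ-fromℕ<; toℕ-injective; toℕ<n; lower₁-injective; injective⇒≤;
         0≢1+n; suc-injective)
open import Data.Maybe using (Maybe; just; nothing)
open import Data.Nat
  using (ℕ; zero; suc; _+_; _≤_; _<_; _≤′_; ≤′-refl; ≤′-step; z≤n; s≤s; s≤s⁻¹; +-0-rawMonoid)
open import Data.Nat.Properties
  using (≤-refl; ≤-reflexive; ≤-antisym; <⇒≤; <-trans; ≤-<-trans; <-≤-trans; ≤-trans;
         +-mono-≤; +-mono-<-≤; +-mono-≤-<; 1+n≰n; ≰⇒>; ≤⇒≤′; _<?_; _≤?_)
  renaming (_≟_ to _≟ℕ_)
open import Data.Product using (Σ; ∃-syntax; _×_; _,_; proj₁; proj₂)
open import Data.Sum using (_⊎_; inj₁; inj₂)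
open import Data.Unit using (⊤; tt)
open import Data.Vec.Functional using (updateAt)
open import Data.Vec.Functional.Properties using (updateAt-updates; updateAt-minimal)
open import Function using (_∘_; id; const)
open import Function.Consequences.Propositional using (strictlySurjective⇒surjective)
open import Function.Definitions using (Injective)
open import Relation.Binary.PropositionalEquality using (_≡_; _≢_; refl; sym; trans; cong; subst)
open import Relation.Nullary using (¬_; Dec; yes; no)
open import Relation.Nullary.Decidable using (_×-dec_; _→-dec_; ¬?; toWitness; toWitnessFalse)

open import Algebra.Definitions.RawMonoid +-0-rawMonoid using (sum)

module _ {n : ℕ} (G : Graph n) where

  Adj? : ∀ u v → Dec (Adj G u v)
  Adj? u v = adj G u v ≟ᵇ true

  Adj-sym : ∀ {u v} → Adj G u v → Adj G v u
  Adj-sym {u} {v} uv = trans (adj-sym G v u) uv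

  Adj-irrefl : ∀ {v} → ¬ Adj G v v
  Adj-irrefl {v} vv with trans (sym (adj-irr G v)) vv
  ... | ()

  Adj⇒≢ : ∀ {u v} → Adj G u v → u ≢ v
  Adj⇒≢ uv refl = Adj-irrefl uv

upperBound : ∀ {P : ℕ → Set} b → (∀ {j} → b < j → ¬ P j) → ∀ j → P j → j ≤ b
upperBound b noneAbove j pj with j ≤? b
... | yes j≤b = j≤b
... | no j≰b = ⊥-elim (noneAbove (≰⇒> j≰b) pj)

-- Finite sums of naturals are monotone, and strictly so if one summand decreases
-- strictly; this is the termination measure of the Grundy repair below.
sum-mono-≤ : ∀ {m} {f g : Fin m → ℕ} → (∀ i → f i ≤ g i) → sum f ≤ sum g
sum-mono-≤ {zero} f≤g = z≤n
sum-mono-≤ {suc m} f≤g = +-mono-≤ (f≤g zero) (sum-mono-≤ (f≤g ∘ suc))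

sum-mono-< : ∀ {m} {f g : Fin m → ℕ} → (∀ i → f i ≤ g i) → ∀ i → f i < g i → sum f < sum g
sum-mono-< {suc m} f≤g zero fi<gi = +-mono-<-≤ fi<gi (sum-mono-≤ (f≤g ∘ suc))
sum-mono-< {suc m} f≤g (suc i) fi<gi = +-mono-≤-< (f≤g zero) (sum-mono-< (f≤g ∘ suc) i fi<gi)

-- Colourings of a graph H with colours Fin k (colour toℕ j stands for j + 1).
module Colourings {m : ℕ} (H : Graph m) {k : ℕ} where

  NeighbourColoured : (Fin m → Fin k) → Fin m → Fin k → Set
  NeighbourColoured c v j = ∃[ u ] (Adj H v u × c u ≡ j)

  GrundyCondition : (Fin m → Fin k) → Set
  GrundyCondition c = ∀ v (j : Fin k) → toℕ j < toℕ (c v) → NeighbourColoured c v j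

  Defect : (Fin m → Fin k) → Fin m → Fin k → Set
  Defect c v j = toℕ j < toℕ (c v) × ¬ NeighbourColoured c v j

  neighbourColoured? : ∀ c v j → Dec (NeighbourColoured c v j)
  neighbourColoured? c v j = any? λ u → Adj? H v u ×-dec (c u ≟ j)

  defect? : ∀ c → Dec (∃[ v ] ∃[ j ] Defect c v j)
  defect? c = any? λ v → any? λ j → (toℕ j <? toℕ (c v)) ×-dec ¬? (neighbourColoured? c v j)

  defectFree⇒grundy : ∀ c → ¬ (∃[ v ] ∃[ j ] Defect c v j) → GrundyCondition c
  defectFree⇒grundy c noDefect v j j<v with neighbourColoured? c v j
  ... | yes coloured = coloured
  ... | no uncoloured = ⊥-elim (noDefect (v , j , j<v , uncoloured))

  proper? : ∀ (c : Fin m → Fin k) → Dec (Proper H c)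
  proper? c = all? λ u → all? λ v → Adj? H u v →-dec ¬? (c u ≟ c v)

  recolour : (Fin m → Fin k) → Fin m → Fin k → Fin m → Fin k
  recolour c v j = updateAt c v (const j)

  recolour-at : ∀ c v j → recolour c v j v ≡ j
  recolour-at c v j = updateAt-updates v c

  recolour-off : ∀ c {v} j {w} → w ≢ v → recolour c v j w ≡ c w
  recolour-off c {v} j {w} w≢v = updateAt-minimal w v c w≢v

  recolour-proper : ∀ {c v j} → Proper H c → ¬ NeighbourColoured c v j → Proper H (recolour c v j)
  recolour-proper {c} {v} {j} proper free u w uw with u ≟ v | w ≟ v
  ... | yes refl | yes refl = ⊥-elim (Adj-irrefl H uw)
  ... | yes refl | no w≢v = λ same →
    free (w , uw , trans (sym (recolour-off c j w≢v)) (trans (sym same) (recolour-at c v j)))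
  ... | no u≢v | yes refl = λ same →
    free (u , Adj-sym H uw , trans (sym (recolour-off c j u≢v)) (trans same (recolour-at c v j)))
  ... | no u≢v | no w≢v = λ same →
    proper u w uw (trans (sym (recolour-off c j u≢v)) (trans same (recolour-off c j w≢v)))

  weight : (Fin m → Fin k) → ℕ
  weight c = sum (toℕ ∘ c)

  recolour-lowers : ∀ {c v j} → toℕ j < toℕ (c v) → weight (recolour c v j) < weight c
  recolour-lowers {c} {v} {j} j<v =
    sum-mono-< pointwise v (≤-<-trans (≤-reflexive (cong toℕ (recolour-at c v j))) j<v)
    where
    pointwise : ∀ w → toℕ (recolour c v j w) ≤ toℕ (c w)
    pointwise w with w ≟ v
    ... | yes refl = ≤-trans (≤-reflexive (cong toℕ (recolour-at c v j))) (<⇒≤ j<v)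
    ... | no w≢v = ≤-reflexive (cong toℕ (recolour-off c j w≢v))

  -- Repair defects one at a time; the weight bounds the number of repairs.
  repair : ∀ fuel c → weight c < fuel → Proper H c →
           Σ (Fin m → Fin k) λ c′ → Proper H c′ × GrundyCondition c′
  repair zero c () proper
  repair (suc fuel) c bound proper with defect? c
  ... | no noDefect = c , proper , defectFree⇒grundy c noDefect
  ... | yes (v , j , j<v , free) =
    repair fuel (recolour c v j) (<-≤-trans (recolour-lowers j<v) (s≤s⁻¹ bound))
      (recolour-proper proper free)

  grundyRepair : ∀ c → Proper H c → Σ (Fin m → Fin k) λ c′ → Proper H c′ × GrundyCondition c′
  grundyRepair c = repair (suc (weight c)) c ≤-refl

open Colourings

AtMostTwoNeighbours : ∀ {n} → Graph n → Set
AtMostTwoNeighbours {n} G = ∀ v → ∃[ p ] ∃[ q ] (∀ u → Adj G v u → u ≡ p ⊎ u ≡ q)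

pigeonhole : ∀ {A : Set} {p q x y z : A} → x ≡ p ⊎ x ≡ q → y ≡ p ⊎ y ≡ q → z ≡ p ⊎ z ≡ q →
             x ≡ y ⊎ x ≡ z ⊎ y ≡ z
pigeonhole (inj₁ refl) (inj₁ refl) _ = inj₁ refl
pigeonhole (inj₂ refl) (inj₂ refl) _ = inj₁ refl
pigeonhole (inj₁ refl) (inj₂ refl) (inj₁ refl) = inj₂ (inj₁ refl)
pigeonhole (inj₁ refl) (inj₂ refl) (inj₂ refl) = inj₂ (inj₂ refl)
pigeonhole (inj₂ refl) (inj₁ refl) (inj₁ refl) = inj₂ (inj₂ refl)
pigeonhole (inj₂ refl) (inj₁ refl) (inj₂ refl) = inj₂ (inj₁ refl)

notAmongTwo : ∀ {n k} (G : Graph n) (c : Fin n → Fin (3 + k)) {v p q} →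
              (∀ u → Adj G v u → u ≡ p ⊎ u ≡ q) → NeighbourColoured G c v zero →
              NeighbourColoured G c v (suc zero) → NeighbourColoured G c v (suc (suc zero)) → ⊥
notAmongTwo G c among (u₀ , vu₀ , c₀) (u₁ , vu₁ , c₁) (u₂ , vu₂ , c₂)
  with pigeonhole (among u₀ vu₀) (among u₁ vu₁) (among u₂ vu₂)
... | inj₁ refl = 0≢1+n (trans (sym c₀) c₁)
... | inj₂ (inj₁ refl) = 0≢1+n (trans (sym c₀) c₂)
... | inj₂ (inj₂ refl) = 0≢1+n (suc-injective (trans (sym c₁) c₂))

-- In a graph of maximum degree 2 there is no Grundy colouring with at least 4
-- colours: a vertex of colour 4 would need neighbours of colours 1, 2 and 3.
noLargeGrundy : ∀ {n k} (G : Graph n) → AtMostTwoNeighbours G → 3 < k → ¬ HasGrundyColoring G k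
noLargeGrundy G two (s≤s (s≤s (s≤s (s≤s _)))) (c , surjective , _ , grundy)
  with surjective (suc (suc (suc zero)))
... | v , colour4 with two v
... | p , q , among =
  notAmongTwo G c among (smallColour zero (s≤s z≤n)) (smallColour (suc zero) (s≤s (s≤s z≤n)))
    (smallColour (suc (suc zero)) (s≤s (s≤s (s≤s z≤n))))
  where
  smallColour : ∀ j → toℕ j < 3 → NeighbourColoured G c v j
  smallColour j j<3 = grundy v j (subst (λ x → toℕ j < toℕ x) (sym (colour4 refl)) j<3)

ReachIn-mono : ∀ {n} {G : Graph n} {P Q : Fin n → Set} {u v} →
               (∀ {w} → P w → Q w) → ReachIn G P u v → ReachIn G Q u v
ReachIn-mono P⊆Q (here pu) = here (P⊆Q pu)
ReachIn-mono P⊆Q (step walk vw pw) = step (ReachIn-mono P⊆Q walk) vw (P⊆Q pw)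

forgetFirst : ∀ {k} → Maybe (Fin (suc k)) → Maybe (Fin k)
forgetFirst (just (suc i)) = just i
forgetFirst _ = nothing

forgetFirst-just : ∀ {k} x {i : Fin k} → forgetFirst x ≡ just i → x ≡ just (suc i)
forgetFirst-just (just (suc i)) refl = refl
forgetFirst-just (just zero) ()
forgetFirst-just nothing ()

dropBranchSet : ∀ {n k} {G : Graph n} → HasCompleteMinor G (suc k) → HasCompleteMinor G k
dropBranchSet {n} {k} {G} (b , nonempty , connected , touching) =
  forgetFirst ∘ b , nonempty′ , connected′ , touching′
  where
  nonempty′ : ∀ (i : Fin k) → ∃[ v ] (forgetFirst (b v) ≡ just i)
  nonempty′ i with nonempty (suc i)
  ... | v , bv = v , cong forgetFirst bv
  connected′ : ∀ (i : Fin k) u v → forgetFirst (b u) ≡ just i → forgetFirst (b v) ≡ just i →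
               ReachIn G (λ w → forgetFirst (b w) ≡ just i) u v
  connected′ i u v bu bv =
    ReachIn-mono (cong forgetFirst) (connected (suc i) u v (forgetFirst-just _ bu) (forgetFirst-just _ bv))
  touching′ : ∀ (i j : Fin k) → i ≢ j →
              ∃[ u ] ∃[ v ] (forgetFirst (b u) ≡ just i × forgetFirst (b v) ≡ just j × Adj G u v)
  touching′ i j i≢j with touching (suc i) (suc j) (i≢j ∘ suc-injective)
  ... | u , v , bu , bv , uv = u , v , cong forgetFirst bu , cong forgetFirst bv , uv

minor-mono : ∀ {n k l} {G : Graph n} → k ≤′ l → HasCompleteMinor G l → HasCompleteMinor G k
minor-mono ≤′-refl = id
minor-mono (≤′-step k≤l) = minor-mono k≤l ∘ dropBranchSet

TwinFree : ∀ {m} → Graph m → Set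
TwinFree {m} H = ∀ u v → (∀ w → adj H u w ≡ adj H v w) → u ≡ v

reflecting⇒injective : ∀ {m n} {H : Graph m} {G : Graph n} {f : Fin m → Fin n} → TwinFree H →
                       (∀ u v → adj H u v ≡ adj G (f u) (f v)) → Injective _≡_ _≡_ f
reflecting⇒injective {G = G} {f} twinFree copy {u} {v} fu≡fv = twinFree u v λ w →
  trans (copy u w) (trans (cong (λ x → adj G x (f w)) fu≡fv) (sym (copy v w)))

pattern f0 = zero
pattern f1 = suc zero
pattern f2 = suc (suc zero)
pattern f3 = suc (suc (suc zero))

tab4 : ∀ {A : Set} → A → A → A → A → Fin 4 → A
tab4 a b c d f0 = a
tab4 a b c d f1 = b
tab4 a b c d f2 = c
tab4 a b c d f3 = d

adjP4 : Fin 4 → Fin 4 → Bool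
adjP4 f0 f1 = true
adjP4 f1 f0 = true
adjP4 f1 f2 = true
adjP4 f2 f1 = true
adjP4 f2 f3 = true
adjP4 f3 f2 = true
adjP4 _ _ = false

P4 : Graph 4
P4 = record
  { adj = adjP4
  ; adj-sym = toWitness {a? = all? λ u → all? λ v → adjP4 u v ≟ᵇ adjP4 v u} _
  ; adj-irr = toWitness {a? = all? λ v → adjP4 v v ≟ᵇ false} _
  }

P4-twinFree : TwinFree P4
P4-twinFree =
  toWitness {a? = all? λ u → all? λ v → (all? λ w → adjP4 u w ≟ᵇ adjP4 v w) →-dec (u ≟ v)} _

P4-atMostTwoNeighbours : AtMostTwoNeighbours P4
P4-atMostTwoNeighbours f0 = f1 , f1 , λ { f1 _ → inj₁ refl ; f0 () ; f2 () ; f3 () }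
P4-atMostTwoNeighbours f1 = f0 , f2 , λ { f0 _ → inj₁ refl ; f2 _ → inj₂ refl ; f1 () ; f3 () }
P4-atMostTwoNeighbours f2 = f1 , f3 , λ { f1 _ → inj₁ refl ; f3 _ → inj₂ refl ; f0 () ; f2 () }
P4-atMostTwoNeighbours f3 = f2 , f2 , λ { f2 _ → inj₁ refl ; f0 () ; f1 () ; f3 () }

P4-grundy3 : HasGrundyColoring P4 3
P4-grundy3 =
  c , strictlySurjective⇒surjective (toWitness {a? = all? λ j → any? λ v → c v ≟ j} _)
    , toWitness {a? = proper? P4 c} _
    , defectFree⇒grundy P4 c (toWitnessFalse {a? = defect? P4 c} _)
  where
  c : Fin 4 → Fin 3
  c = tab4 zero (suc zero) (suc (suc zero)) zero

P4-Grundy : IsGrundyNumber P4 3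
P4-Grundy = P4-grundy3 , upperBound 3 (noLargeGrundy P4 P4-atMostTwoNeighbours)

P4-minor2 : HasCompleteMinor P4 2
P4-minor2 = b , nonempty , connected , touching
  where
  b : Fin 4 → Maybe (Fin 2)
  b = tab4 (just zero) (just (suc zero)) nothing nothing
  nonempty : ∀ (i : Fin 2) → ∃[ v ] (b v ≡ just i)
  nonempty zero = f0 , refl
  nonempty (suc zero) = f1 , refl
  connected : ∀ (i : Fin 2) u v → b u ≡ just i → b v ≡ just i → ReachIn P4 (λ w → b w ≡ just i) u v
  connected i f0 f0 bu _ = here bu
  connected i f1 f1 bu _ = here bu
  connected i f0 f1 refl ()
  connected i f1 f0 refl ()
  connected i f2 _ () _
  connected i f3 _ () _
  connected i _ f2 _ ()
  connected i _ f3 _ ()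
  touching : ∀ (i j : Fin 2) → i ≢ j → ∃[ u ] ∃[ v ] (b u ≡ just i × b v ≡ just j × Adj P4 u v)
  touching zero zero i≢j = ⊥-elim (i≢j refl)
  touching zero (suc zero) _ = f0 , f1 , refl , refl , refl
  touching (suc zero) zero _ = f1 , f0 , refl , refl , refl
  touching (suc zero) (suc zero) i≢j = ⊥-elim (i≢j refl)

-- Connected vertex sets of P₄ are intervals: a walk inside S from an inner
-- vertex towards the far end must pass through the next vertex.
module _ (S : Fin 4 → Set) where

  walkFrom0 : ∀ {w} → ReachIn P4 S f0 w → w ≡ f0 ⊎ S f1
  walkFrom0 (here _) = inj₁ refl
  walkFrom0 (step {w = w} walk vw sw) with walkFrom0 walk
  ... | inj₂ s1 = inj₂ s1
  ... | inj₁ refl = leave0 w vw sw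
    where
    leave0 : ∀ w → Adj P4 f0 w → S w → w ≡ f0 ⊎ S f1
    leave0 f1 _ s1 = inj₂ s1
    leave0 f0 ()
    leave0 f2 ()
    leave0 f3 ()

  walkFrom1 : ∀ {w} → ReachIn P4 S f1 w → (w ≡ f0 ⊎ w ≡ f1) ⊎ S f2
  walkFrom1 (here _) = inj₁ (inj₂ refl)
  walkFrom1 (step {w = w} walk vw sw) with walkFrom1 walk
  ... | inj₂ s2 = inj₂ s2
  ... | inj₁ (inj₁ refl) = leave0 w vw
    where
    leave0 : ∀ w → Adj P4 f0 w → (w ≡ f0 ⊎ w ≡ f1) ⊎ S f2
    leave0 f1 _ = inj₁ (inj₂ refl)
    leave0 f0 ()
    leave0 f2 ()
    leave0 f3 ()
  ... | inj₁ (inj₂ refl) = leave1 w vw sw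
    where
    leave1 : ∀ w → Adj P4 f1 w → S w → (w ≡ f0 ⊎ w ≡ f1) ⊎ S f2
    leave1 f0 _ _ = inj₁ (inj₁ refl)
    leave1 f2 _ s2 = inj₂ s2
    leave1 f1 ()
    leave1 f3 ()

  between02 : ReachIn P4 S f0 f2 → S f1
  between02 walk with walkFrom0 walk
  ... | inj₂ s1 = s1

  between03 : ReachIn P4 S f0 f3 → S f1
  between03 walk with walkFrom0 walk
  ... | inj₂ s1 = s1

  between13 : ReachIn P4 S f1 f3 → S f2
  between13 walk with walkFrom1 walk
  ... | inj₂ s2 = s2
  ... | inj₁ (inj₁ ())
  ... | inj₁ (inj₂ ())

-- A K₃ minor of P₄ induces a labelling of its vertices (0: in no branch set,
-- suc c: in branch set c) in which the three labelled classes pairwise touch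
-- and are intervals; an exhaustive check shows no such labelling exists.
label : Maybe (Fin 3) → Fin 4
label nothing = zero
label (just c) = suc c

label-just : ∀ x {c} → label x ≡ suc c → x ≡ just c
label-just (just _) refl = refl
label-just nothing ()

Touch : (Fin 4 → Fin 4) → Fin 4 → Fin 4 → Set
Touch y s t = ∃[ u ] ∃[ v ] (Adj P4 u v × y u ≡ s × y v ≡ t)

-- The vertices labelled s form an interval (in the cases needed below).
Interval : (Fin 4 → Fin 4) → Fin 4 → Set
Interval y s = (y f0 ≡ s → y f2 ≡ s → y f1 ≡ s) × (y f0 ≡ s → y f3 ≡ s → y f1 ≡ s) ×
               (y f1 ≡ s → y f3 ≡ s → y f2 ≡ s)

K3Labelling : (Fin 4 → Fin 4) → Set
K3Labelling y = Touch y f1 f2 × Touch y f1 f3 × Touch y f2 f3 × Interval y f1 × Interval y f2 × Interval y f3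

k3Labelling? : ∀ y → Dec (K3Labelling y)
k3Labelling? y =
  touch? f1 f2 ×-dec touch? f1 f3 ×-dec touch? f2 f3 ×-dec interval? f1 ×-dec interval? f2 ×-dec interval? f3
  where
  touch? : ∀ s t → Dec (Touch y s t)
  touch? s t = any? λ u → any? λ v → Adj? P4 u v ×-dec (y u ≟ s ×-dec y v ≟ t)
  interval? : ∀ s → Dec (Interval y s)
  interval? s = (y f0 ≟ s →-dec (y f2 ≟ s →-dec y f1 ≟ s)) ×-dec
                (y f0 ≟ s →-dec (y f3 ≟ s →-dec y f1 ≟ s)) ×-dec
                (y f1 ≟ s →-dec (y f3 ≟ s →-dec y f2 ≟ s))

noK3Labelling : ∀ a b c d → ¬ K3Labelling (tab4 a b c d)
noK3Labelling =
  toWitness {a? = all? λ a → all? λ b → all? λ c → all? λ d → ¬? (k3Labelling? (tab4 a b c d))} _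

P4-noK3 : ¬ HasCompleteMinor P4 3
P4-noK3 (b , _ , connected , touching) =
  noK3Labelling (y f0) (y f1) (y f2) (y f3)
    (touch zero (suc zero) (λ ()) , touch zero (suc (suc zero)) (λ ()) ,
     touch (suc zero) (suc (suc zero)) (λ ()) , interval zero , interval (suc zero) , interval (suc (suc zero)))
  where
  y : Fin 4 → Fin 4
  y = label ∘ b
  ŷ : Fin 4 → Fin 4
  ŷ = tab4 (y f0) (y f1) (y f2) (y f3)
  ŷ≗y : ∀ u → ŷ u ≡ y u
  ŷ≗y f0 = refl
  ŷ≗y f1 = refl
  ŷ≗y f2 = refl
  ŷ≗y f3 = refl
  touch : ∀ i j → i ≢ j → Touch ŷ (suc i) (suc j)
  touch i j i≢j with touching i j i≢j
  ... | u , v , bu , bv , uv = u , v , uv , trans (ŷ≗y u) (cong label bu) , trans (ŷ≗y v) (cong label bv)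
  interval : ∀ c → Interval ŷ (suc c)
  interval c =
    (λ y0 y2 → cong label (between02 inBranch (walk y0 y2))) ,
    (λ y0 y3 → cong label (between03 inBranch (walk y0 y3))) ,
    (λ y1 y3 → cong label (between13 inBranch (walk y1 y3)))
    where
    inBranch : Fin 4 → Set
    inBranch w = b w ≡ just c
    walk : ∀ {u v} → y u ≡ suc c → y v ≡ suc c → ReachIn P4 inBranch u v
    walk {u} {v} yu yv = connected c u v (label-just (b u) yu) (label-just (b v) yv)

P4-Hadwiger : IsHadwigerNumber P4 2
P4-Hadwiger = P4-minor2 , upperBound 2 λ 2<j → P4-noK3 ∘ minor-mono (≤⇒≤′ 2<j)

P4Free : ∀ {n} → Graph n → Set
P4Free {n} G = ∀ (f : Fin 4 → Fin n) → ¬ (∀ u v → adj P4 u v ≡ adj G (f u) (f v))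

ΓhPerfect⇒P4Free : ∀ {n} (G : Graph n) → ΓhPerfect G → P4Free G
ΓhPerfect⇒P4Free G perfect f copy =
  3≢2 (perfect P4 (f , reflecting⇒injective {H = P4} {G = G} P4-twinFree copy , copy) 3 2 P4-Grundy P4-Hadwiger)
  where
  3≢2 : 3 ≢ 2
  3≢2 ()

P4Free-induced : ∀ {m n} {H : Graph m} {G : Graph n} → IsInducedSubgraph H G → P4Free G → P4Free H
P4Free-induced (g , _ , sameAdj) free f copy = free (g ∘ f) λ u v → trans (copy u v) (sameAdj (f u) (f v))

noInducedPath : ∀ {n} {G : Graph n} → P4Free G → ∀ {a b c d} → Adj G a b → Adj G b c → Adj G c d →
                ¬ Adj G a c → ¬ Adj G b d → ¬ Adj G a d → ⊥
noInducedPath {G = G} free {a} {b} {c} {d} ab bc cd ¬ac ¬bd ¬ad = free (tab4 a b c d) copy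
  where
  nonEdge : ∀ {u v} → ¬ Adj G u v → false ≡ adj G u v
  nonEdge ¬uv = sym (¬-not ¬uv)
  copy : ∀ u v → adjP4 u v ≡ adj G (tab4 a b c d u) (tab4 a b c d v)
  copy f0 f0 = sym (adj-irr G a)
  copy f1 f1 = sym (adj-irr G b)
  copy f2 f2 = sym (adj-irr G c)
  copy f3 f3 = sym (adj-irr G d)
  copy f0 f1 = sym ab
  copy f1 f0 = sym (Adj-sym G ab)
  copy f1 f2 = sym bc
  copy f2 f1 = sym (Adj-sym G bc)
  copy f2 f3 = sym cd
  copy f3 f2 = sym (Adj-sym G cd)
  copy f0 f2 = nonEdge ¬ac
  copy f2 f0 = nonEdge (¬ac ∘ Adj-sym G)
  copy f1 f3 = nonEdge ¬bd
  copy f3 f1 = nonEdge (¬bd ∘ Adj-sym G)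
  copy f0 f3 = nonEdge ¬ad
  copy f3 f0 = nonEdge (¬ad ∘ Adj-sym G)

module Cliques {m : ℕ} (H : Graph m) where

  CliqueIn : (Fin m → Set) → ℕ → Set
  CliqueIn S l = Σ (Fin l → Fin m) λ g →
    Injective _≡_ _≡_ g × (∀ i j → i ≢ j → Adj H (g i) (g j)) × (∀ i → S (g i))

  CliqueIn-mono : ∀ {S T : Fin m → Set} {l} → (∀ {u} → S u → T u) → CliqueIn S l → CliqueIn T l
  CliqueIn-mono S⊆T (g , injective , adjacent , inS) = g , injective , adjacent , S⊆T ∘ inS

  singleton : ∀ {S : Fin m → Set} {v} → S v → CliqueIn S 1
  singleton {v = v} sv =
    (λ _ → v) , (λ { {zero} {zero} _ → refl }) , (λ { zero zero 0≢0 → ⊥-elim (0≢0 refl) }) , λ _ → sv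

  extend : ∀ {S : Fin m → Set} {v l} → S v → CliqueIn (λ u → S u × Adj H v u) l → CliqueIn S (suc l)
  extend {S} {v} {l} sv (g , injective , adjacent , inS) = g′ , injective′ , adjacent′ , inS′
    where
    g′ : Fin (suc l) → Fin m
    g′ zero = v
    g′ (suc i) = g i
    injective′ : Injective _≡_ _≡_ g′
    injective′ {zero} {zero} _ = refl
    injective′ {zero} {suc j} v≡gj = ⊥-elim (Adj⇒≢ H (proj₂ (inS j)) v≡gj)
    injective′ {suc i} {zero} gi≡v = ⊥-elim (Adj⇒≢ H (proj₂ (inS i)) (sym gi≡v))
    injective′ {suc i} {suc j} gi≡gj = cong suc (injective gi≡gj)
    adjacent′ : ∀ i j → i ≢ j → Adj H (g′ i) (g′ j)
    adjacent′ zero zero 0≢0 = ⊥-elim (0≢0 refl)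
    adjacent′ zero (suc j) _ = proj₂ (inS j)
    adjacent′ (suc i) zero _ = Adj-sym H (proj₂ (inS i))
    adjacent′ (suc i) (suc j) i≢j = adjacent i j (i≢j ∘ cong suc)
    inS′ : ∀ i → S (g′ i)
    inS′ zero = sv
    inS′ (suc i) = proj₁ (inS i)

  module _ (free : P4Free H) {k} {c : Fin m → Fin k} (proper : Proper H c) where

    GrundyOn : (Fin m → Set) → Set
    GrundyOn S = ∀ v → S v → ∀ j → j < toℕ (c v) → ∃[ u ] (S u × Adj H v u × toℕ (c u) ≡ j)

    LowerNeighbour : (Fin m → Set) → Fin m → Fin m → Set
    LowerNeighbour S v u = S u × Adj H v u × toℕ (c u) < toℕ (c v)

    -- The key use of P₄-freeness: if u is a lower neighbour of v and w, w′ are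
    -- neighbours of u and v of the same colour j, then w ~ v or u ~ w′, since
    -- otherwise w-u-v-w′ is an induced P₄ (w ≁ w′ as they share a colour).
    grundyOn-lower : ∀ {S v} → GrundyOn S → S v → GrundyOn (LowerNeighbour S v)
    grundyOn-lower {S} {v} grundy sv u (su , vu , u<v) j j<u
      with grundy u su j j<u | grundy v sv j (<-trans j<u u<v)
    ... | w , sw , uw , cw | w′ , sw′ , vw′ , cw′ with Adj? H v w | Adj? H u w′
    ... | yes vw | _ = w , (sw , vw , subst (_< toℕ (c v)) (sym cw) (<-trans j<u u<v)) , uw , cw
    ... | no _ | yes uw′ = w′ , (sw′ , vw′ , subst (_< toℕ (c v)) (sym cw′) (<-trans j<u u<v)) , uw′ , cw′
    ... | no ¬vw | no ¬uw′ =
      ⊥-elim (noInducedPath {G = H} free (Adj-sym H uw) (Adj-sym H vu) vw′ (¬vw ∘ Adj-sym H) ¬uw′ sameColour)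
      where
      sameColour : ¬ Adj H w w′
      sameColour ww′ = proper w w′ ww′ (toℕ-injective (trans cw (sym cw′)))

    cliqueBelow : ∀ i {S} → GrundyOn S → ∀ {v} → S v → toℕ (c v) ≡ i → CliqueIn S (suc i)
    cliqueBelow zero {S} _ sv _ = singleton {S} sv
    cliqueBelow (suc i) {S} grundy {v} sv cv≡1+i with grundy v sv i (≤-reflexive (sym cv≡1+i))
    ... | u , su , vu , cu≡i =
      extend {S} sv (CliqueIn-mono {LowerNeighbour S v} (λ (su , vu , _) → su , vu)
        (cliqueBelow i (grundyOn-lower grundy sv) (su , vu , u<v) cu≡i))
      where
      u<v : toℕ (c u) < toℕ (c v)
      u<v = ≤-reflexive (trans (cong suc cu≡i) (sym cv≡1+i))

    grundyClique : GrundyCondition H c → ∀ v → HasClique H (suc (toℕ (c v)))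
    grundyClique grundy v =
      let (g , injective , adjacent , _) = cliqueBelow (toℕ (c v)) everywhere {v} tt refl
      in g , injective , adjacent
      where
      everywhere : GrundyOn (λ _ → ⊤)
      everywhere v _ j j<v with grundy v (fromℕ< (<-trans j<v (toℕ<n (c v))))
                                  (subst (_< toℕ (c v)) (sym (toℕ-fromℕ< _)) j<v)
      ... | u , vu , cu = u , tt , vu , trans (cong toℕ cu) (toℕ-fromℕ< _)

open Cliques

-- ω ≤ χ in every graph: a proper colouring is injective on a clique.
clique≤colours : ∀ {m a b} (H : Graph m) → HasClique H a → HasProperColoring H b → a ≤ b
clique≤colours H (g , _ , adjacent) (c , proper) = injective⇒≤ colour-injective
  where
  colour-injective : Injective _≡_ _≡_ (c ∘ g)
  colour-injective {i} {j} same with i ≟ j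
  ... | yes i≡j = i≡j
  ... | no i≢j = ⊥-elim (proper (g i) (g j) (adjacent i j i≢j) same)

dropTopColour : ∀ {m k} (H : Graph m) {c : Fin m → Fin (suc k)} → Proper H c →
                (∀ v → k ≢ toℕ (c v)) → HasProperColoring H k
dropTopColour H {c} proper unused =
  (λ v → lower₁ (c v) (unused v)) , λ u v uv same → proper u v uv (lower₁-injective same)

-- χ ≤ ω for P₄-free graphs: Grundy-repair an optimal colouring; by minimality
-- its top colour is used, and that vertex spans a clique of size χ.
chromatic⇒clique : ∀ {m b} (H : Graph m) → P4Free H → IsChromaticNumber H b → HasClique H b
chromatic⇒clique {b = zero} H _ _ = (λ ()) , (λ { {()} }) , λ ()
chromatic⇒clique {b = suc k} H free ((c , proper) , minimal) with grundyRepair H c proper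
... | c′ , proper′ , grundy with any? (λ v → k ≟ℕ toℕ (c′ v))
...   | yes (v , k≡cv) = subst (HasClique H ∘ suc) (sym k≡cv) (grundyClique H free proper′ grundy v)
...   | no unused = ⊥-elim (1+n≰n (minimal k (dropTopColour H proper′ λ v k≡cv → unused (v , k≡cv))))

corollary8 : ∀ {n : ℕ} (G : Graph n) → ΓhPerfect G → ωχPerfect G
corollary8 G perfect H induced a b (clique , maximal) chromatic@(colouring , _) =
  ≤-antisym (clique≤colours H clique colouring) (maximal b (chromatic⇒clique H H-P4Free chromatic))
  where
  H-P4Free : P4Free H
  H-P4Free = P4Free-induced {H = H} {G = G} induced (ΓhPerfect⇒P4Free G perfect)
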